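{- Let $a,b,n$ be positive integers with $1\le a<b$, and let $G$ be a finite simple graph with minimum degree $\delta(G)\geq a+n$. If for every $n$-element subset $V'\subset V(G)$ the graph $G-V'$ has an $[a,b]$-factor, then for every $(n-1)$-element subset $V''\subset V(G)$ the graph $G-V''$ also has an $[a,b]$-factor.
   Context: A spanning subgraph $H$ of $G$ is an $[a,b]$-factor if $a\le d_H(x)\le b$ for every $x\in V(G)$. -}

module Defs where

open import Data.Nat using (ℕ; _+_; _≤_)
open import Data.Bool using (Bool; true; false; if_then_else_)
open import Data.Fin using (Fin)
open import Data.Fin.Subset using (Subset; _∈_; _∉_)
open import Data.List using (map; allFin)
open import Data.Nat.ListAction using (sum)
open import Data.Product using (_×_; Σ)
open import Relation.Binary.PropositionalEquality using (_≡_)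

record Graph (m : ℕ) : Set where
  field
    adj   : Fin m → Fin m → Bool
    sym   : ∀ x y → adj x y ≡ adj y x
    irref : ∀ x → adj x x ≡ false
open Graph public

deg : ∀ {m} → (Fin m → Fin m → Bool) → Fin m → ℕ
deg {m} A x = sum (map (λ y → if A x y then 1 else 0) (allFin m))

MinDegree≥ : ∀ {m} → Graph m → ℕ → Set
MinDegree≥ G d = ∀ x → d ≤ deg (adj G) x

-- H is an [a,b]-factor of G - S: a spanning subgraph H of G - S, i.e. H is a
-- symmetric edge subset of G, using only vertices outside S, such that
-- every vertex x of G - S has a ≤ d_H(x) ≤ b.
IsFactorOfDeletion : ∀ {m} → Graph m → Subset m → ℕ → ℕ →
                     (Fin m → Fin m → Bool) → Set
IsFactorOfDeletion {m} G S a b H =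
  (∀ x y → H x y ≡ H y x) ×
  (∀ x y → H x y ≡ true → adj G x y ≡ true) ×
  (∀ x y → H x y ≡ true → x ∉ S) ×
  (∀ x → x ∉ S → a ≤ deg H x × deg H x ≤ b)

HasFactorAfterDeleting : ∀ {m} → Graph m → Subset m → ℕ → ℕ → Set
HasFactorAfterDeleting {m} G S a b =
  Σ (Fin m → Fin m → Bool) (IsFactorOfDeletion G S a b)

-- Fix v ∉ T.  A factor of G − (T ∪ {v}) is an [a,b]-factor of G − T except that v has degree
-- 0 < a; we raise the degree of v one unit at a time, keeping every other vertex of G − T in
-- [a,b] and v at most b.  If some other vertex w ∉ T has degree above a, take a factor K of
-- G − (T ∪ {w}): since deg_K v ≥ a > deg_H v, switching H along an H/K-alternating walk from v
-- raises v and moves at most one other vertex one step towards its K-degree, staying in [a,b];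
-- w itself, of K-degree 0, can only drop from above a to at least a.  Otherwise every vertex of
-- G − T has H-degree at most a, and δ(G) ≥ a + n > deg_H v + |T| gives a neighbour y ∉ T of v
-- with vy ∉ H; adding vy keeps deg y ≤ a + 1 ≤ b.
module Submission where

open import Defs
open import Data.Nat using (ℕ; zero; suc; _+_; _∸_; _≤_; _<_; z≤n; s≤s; _<?_; _≤?_)
open import Data.Nat.Properties
open import Data.Nat.Tactic.RingSolver using (solve-∀)
open import Data.Bool using (Bool; true; false; not; _xor_; if_then_else_)
open import Data.Bool.Properties using (not-¬; xor-same; not-distribˡ-xor)
open import Data.Fin using (Fin; zero; suc; punchIn)
open import Data.Fin.Properties using (any?; punchInᵢ≢i) renaming (_≟_ to _≟ᶠ_)
open import Data.Fin.Subset as Subset using (Subset; ∣_∣; ⁅_⁆; _∈_; _∉_)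
open import Data.Fin.Subset.Properties using (_∈?_; x∈⁅x⁆; x∈⁅y⁆⇒x≡y; x∈p∪q⁺; x∈p∪q⁻; ∪-identityˡ)
open import Data.Vec using ([]; _∷_; lookup; here; there)
open import Data.Vec.Properties using ([]=⇒lookup)
open import Data.List using (tabulate)
open import Data.List.Properties using (map-tabulate)
import Data.Nat.ListAction as List
open import Data.Product using (Σ; ∃; _×_; _,_; proj₁; proj₂)
open import Data.Sum using (_⊎_; inj₁; inj₂; [_,_]′)
open import Data.Empty using (⊥; ⊥-elim)
open import Function using (_∘_; id)
open import Induction.WellFounded using (Acc; acc)
open import Data.Nat.Induction using (<-wellFounded)
open import Relation.Nullary using (¬_; Dec; yes; no; contradiction)
open import Relation.Nullary.Decidable using (toSum; _×-dec_; _⊎-dec_; ¬?)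
open import Relation.Binary.PropositionalEquality as ≡ using (_≡_; _≢_; refl; cong; cong₂; subst; trans)
open import Algebra.Properties.CommutativeMonoid.Sum +-0-commutativeMonoid
  using (sum; sum-cong-≗; sum-remove; ∑-distrib-+; sum-replicate-zero)

private
  variable
    m : ℕ

sum-mono-≤ : {f g : Fin m → ℕ} → (∀ i → f i ≤ g i) → sum f ≤ sum g
sum-mono-≤ {zero}  f≤g = z≤n
sum-mono-≤ {suc m} f≤g = +-mono-≤ (f≤g zero) (sum-mono-≤ (f≤g ∘ suc))

sum-mono-< : {f g : Fin m → ℕ} → (∀ i → f i ≤ g i) → ∀ j → f j < g j → sum f < sum g
sum-mono-< {suc m} f≤g zero    fj<gj = +-mono-<-≤ fj<gj (sum-mono-≤ (f≤g ∘ suc))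
sum-mono-< {suc m} f≤g (suc j) fj<gj = +-mono-≤-< (f≤g zero) (sum-mono-< (f≤g ∘ suc) j fj<gj)

sum-<⇒∃< : {f g : Fin m → ℕ} → sum f < sum g → ∃ λ i → f i < g i
sum-<⇒∃< {suc m} {f} {g} Σf<Σg with f zero <? g zero
... | yes f₀<g₀ = zero , f₀<g₀
... | no  f₀≮g₀ =
  let i , fi<gi = sum-<⇒∃< (+-cancelˡ-< (f zero) _ _
                    (<-≤-trans Σf<Σg (+-monoˡ-≤ _ (≮⇒≥ f₀≮g₀))))
  in suc i , fi<gi

sum-update : {f g : Fin m → ℕ} (j : Fin m) → (∀ i → i ≢ j → f i ≡ g i) →
             sum f + g j ≡ sum g + f j
sum-update {suc m} {f} {g} j f≡g = begin
  sum f + g j                     ≡⟨ cong (_+ g j) (sum-remove {i = j} f) ⟩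
  f j + sum (f ∘ punchIn j) + g j ≡⟨ cong (λ r → f j + r + g j) rest ⟩
  f j + sum (g ∘ punchIn j) + g j ≡⟨ swap-ends (f j) _ (g j) ⟩
  g j + sum (g ∘ punchIn j) + f j ≡⟨ cong (_+ f j) (≡.sym (sum-remove {i = j} g)) ⟩
  sum g + f j                     ∎
  where
  open ≡.≡-Reasoning
  rest : sum (f ∘ punchIn j) ≡ sum (g ∘ punchIn j)
  rest = sum-cong-≗ (λ i → f≡g (punchIn j i) (punchInᵢ≢i j i))
  swap-ends : ∀ a r b → a + r + b ≡ b + r + a
  swap-ends = solve-∀

𝟙 : Bool → ℕ
𝟙 b = if b then 1 else 0

𝟙-mono : ∀ {b c} → (b ≡ true → c ≡ true) → 𝟙 b ≤ 𝟙 c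
𝟙-mono {false} b⇒c = z≤n
𝟙-mono {true}  b⇒c rewrite b⇒c refl = ≤-refl

𝟙-<⇒ : ∀ b c → 𝟙 b < 𝟙 c → b ≡ false × c ≡ true
𝟙-<⇒ false true  _ = refl , refl
𝟙-<⇒ true  true  (s≤s ())
𝟙-<⇒ false false ()

Adj : ℕ → Set
Adj m = Fin m → Fin m → Bool

Symmetric : Adj m → Set
Symmetric A = ∀ x y → A x y ≡ A y x

Loopless : Adj m → Set
Loopless A = ∀ x → A x x ≡ false

_⊆_∪_ : Adj m → Adj m → Adj m → Set
A ⊆ B ∪ C = ∀ x y → A x y ≡ true → B x y ≡ true ⊎ C x y ≡ true

deg≡sum : (A : Adj m) (x : Fin m) → deg A x ≡ sum (λ y → 𝟙 (A x y))
deg≡sum A x = trans (cong List.sum (map-tabulate id (𝟙 ∘ A x))) (sum-tabulate (𝟙 ∘ A x))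
  where
  sum-tabulate : ∀ {k} (f : Fin k → ℕ) → List.sum (tabulate f) ≡ sum f
  sum-tabulate {zero}  f = refl
  sum-tabulate {suc k} f = cong (f zero +_) (sum-tabulate (f ∘ suc))

module _ (A B : Adj m) (x : Fin m) where

  deg-cong : (∀ y → A x y ≡ B x y) → deg A x ≡ deg B x
  deg-cong A≡B = begin
    deg A x                  ≡⟨ deg≡sum A x ⟩
    sum (λ y → 𝟙 (A x y))    ≡⟨ sum-cong-≗ (cong 𝟙 ∘ A≡B) ⟩
    sum (λ y → 𝟙 (B x y))    ≡⟨ ≡.sym (deg≡sum B x) ⟩
    deg B x                  ∎
    where open ≡.≡-Reasoning

  deg-mono : (∀ y → A x y ≡ true → B x y ≡ true) → deg A x ≤ deg B x
  deg-mono A⇒B = ≡.subst₂ _≤_ (≡.sym (deg≡sum A x)) (≡.sym (deg≡sum B x))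
    (sum-mono-≤ (λ y → 𝟙-mono (A⇒B y)))

  deg-<⇒∃ : deg A x < deg B x → ∃ λ y → A x y ≡ false × B x y ≡ true
  deg-<⇒∃ lt =
    let y , 𝟙<𝟙 = sum-<⇒∃< (≡.subst₂ _<_ (deg≡sum A x) (deg≡sum B x) lt)
    in y , 𝟙-<⇒ (A x y) (B x y) 𝟙<𝟙

  deg-update : ∀ y → (∀ z → z ≢ y → A x z ≡ B x z) → deg A x + 𝟙 (B x y) ≡ deg B x + 𝟙 (A x y)
  deg-update y A≡B = begin
    deg A x + 𝟙 (B x y)                 ≡⟨ cong (_+ 𝟙 (B x y)) (deg≡sum A x) ⟩
    sum (λ z → 𝟙 (A x z)) + 𝟙 (B x y)   ≡⟨ sum-update y (λ z z≢y → cong 𝟙 (A≡B z z≢y)) ⟩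
    sum (λ z → 𝟙 (B x z)) + 𝟙 (A x y)   ≡⟨ cong (_+ 𝟙 (A x y)) (≡.sym (deg≡sum B x)) ⟩
    deg B x + 𝟙 (A x y)                 ∎
    where open ≡.≡-Reasoning

deg-isolated : (A : Adj m) (x : Fin m) → (∀ y → A x y ≢ true) → deg A x ≡ 0
deg-isolated {m} A x isolated = trans (deg≡sum A x)
  (trans (sum-cong-≗ no-edge) (sum-replicate-zero m))
  where
  no-edge : ∀ y → 𝟙 (A x y) ≡ 0
  no-edge y with A x y in eq
  ... | true  = contradiction eq (isolated y)
  ... | false = refl

IsEdge : (v y x z : Fin m) → Set
IsEdge v y x z = (x ≡ v × z ≡ y) ⊎ (x ≡ y × z ≡ v)

isEdge? : (v y x z : Fin m) → Dec (IsEdge v y x z)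
isEdge? v y x z = ((x ≟ᶠ v) ×-dec (z ≟ᶠ y)) ⊎-dec ((x ≟ᶠ y) ×-dec (z ≟ᶠ v))

IsEdge-flip : ∀ {v y x z : Fin m} → IsEdge v y x z → IsEdge v y z x
IsEdge-flip (inj₁ (x≡v , z≡y)) = inj₂ (z≡y , x≡v)
IsEdge-flip (inj₂ (x≡y , z≡v)) = inj₁ (z≡v , x≡y)

IsEdge-comm : ∀ {v y x z : Fin m} → IsEdge v y x z → IsEdge y v x z
IsEdge-comm (inj₁ e) = inj₂ e
IsEdge-comm (inj₂ e) = inj₁ e

edge-value : ∀ {B : Adj m} {v y x z} → Symmetric B → IsEdge v y x z → B x z ≡ B v y
edge-value B-sym (inj₁ (refl , refl)) = refl
edge-value B-sym (inj₂ (refl , refl)) = B-sym _ _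

setEdge : Adj m → (v y : Fin m) → Bool → Adj m
setEdge A v y c x z with isEdge? v y x z
... | yes _ = c
... | no _  = A x z

module _ (A : Adj m) (c : Bool) {v y : Fin m} where

  setEdge-on : ∀ {x z} → IsEdge v y x z → setEdge A v y c x z ≡ c
  setEdge-on {x} {z} e with isEdge? v y x z
  ... | yes _ = refl
  ... | no ¬e = contradiction e ¬e

  setEdge-off : ∀ {x z} → ¬ IsEdge v y x z → setEdge A v y c x z ≡ A x z
  setEdge-off {x} {z} ¬e with isEdge? v y x z
  ... | yes e = contradiction e ¬e
  ... | no _  = refl

  setEdge-symmetric : Symmetric A → Symmetric (setEdge A v y c)
  setEdge-symmetric A-sym x z =
    [ (λ e → trans (setEdge-on e) (≡.sym (setEdge-on (IsEdge-flip e))))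
    , (λ ¬e → trans (setEdge-off ¬e) (trans (A-sym x z) (≡.sym (setEdge-off (¬e ∘ IsEdge-flip)))))
    ]′ (toSum (isEdge? v y x z))

  setEdge-⊆ : (B : Adj m) → Symmetric B → B v y ≡ c → setEdge A v y c ⊆ A ∪ B
  setEdge-⊆ B B-sym Bvy≡c x z set≡true =
    [ (λ e → inj₂ (trans (edge-value B-sym e) (trans Bvy≡c (trans (≡.sym (setEdge-on e)) set≡true))))
    , (λ ¬e → inj₁ (trans (≡.sym (setEdge-off ¬e)) set≡true))
    ]′ (toSum (isEdge? v y x z))

  deg-setEdge-other : ∀ x → x ≢ v → x ≢ y → deg (setEdge A v y c) x ≡ deg A x
  deg-setEdge-other x x≢v x≢y = deg-cong (setEdge A v y c) A x λ z → setEdge-off λ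
    { (inj₁ (x≡v , _)) → x≢v x≡v
    ; (inj₂ (x≡y , _)) → x≢y x≡y }

  deg-setEdge-end : v ≢ y → deg (setEdge A v y c) v + 𝟙 (A v y) ≡ deg A v + 𝟙 c
  deg-setEdge-end v≢y = trans (deg-update (setEdge A v y c) A v y row)
                              (cong (λ b → deg A v + 𝟙 b) (setEdge-on (inj₁ (refl , refl))))
    where
    row : ∀ z → z ≢ y → setEdge A v y c v z ≡ A v z
    row z z≢y = setEdge-off λ
      { (inj₁ (_ , z≡y)) → z≢y z≡y
      ; (inj₂ (v≡y , _)) → v≢y v≡y }

setEdge-comm : (A : Adj m) (c : Bool) (v y x z : Fin m) → setEdge A v y c x z ≡ setEdge A y v c x z
setEdge-comm A c v y x z =
  [ (λ e → trans (setEdge-on A c e) (≡.sym (setEdge-on A c (IsEdge-comm e))))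
  , (λ ¬e → trans (setEdge-off A c ¬e) (≡.sym (setEdge-off A c (¬e ∘ IsEdge-comm))))
  ]′ (toSum (isEdge? v y x z))

setEdge-false-⊆ : (A : Adj m) (v y x z : Fin m) → setEdge A v y false x z ≡ true → A x z ≡ true
setEdge-false-⊆ A v y x z set≡true with isEdge? v y x z
... | yes _ = contradiction set≡true λ ()
... | no  _ = set≡true

-- A Boolean c is a direction (true: up, false: down); Short c h k says that h must move in
-- direction c to reach k.
Shift : Bool → ℕ → ℕ → Set
Shift true  h h′ = h′ ≡ suc h
Shift false h h′ = suc h′ ≡ h

Short : Bool → ℕ → ℕ → Set
Short true  h k = h < k
Short false h k = k < h

NotPast : Bool → ℕ → ℕ → Set
NotPast true  h k = h ≤ k
NotPast false h k = k ≤ h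

StepToward : ℕ → ℕ → ℕ → Set
StepToward h h′ k = Σ Bool λ c → Short c h k × Shift c h h′

short? : ∀ c h k → Dec (Short c h k)
short? true  h k = h <? k
short? false h k = k <? h

shift-from-𝟙 : ∀ c {h h′} → h′ + 𝟙 (not c) ≡ h + 𝟙 c → Shift c h h′
shift-from-𝟙 true  eq = trans (≡.sym (+-identityʳ _)) (trans eq (+-comm _ 1))
shift-from-𝟙 false eq = trans (+-comm 1 _) (trans eq (+-identityʳ _))

shift-cancel : ∀ c {h h₁ h′} → Shift c h h₁ → Shift (not c) h₁ h′ → h′ ≡ h
shift-cancel true  refl refl = refl
shift-cancel false refl refl = refl

short⇒notPast : ∀ c {h h′ k} → Short c h k → Shift c h h′ → NotPast c h′ k
short⇒notPast true  h<k  refl = h<k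
short⇒notPast false k<h′ refl = ≤-pred k<h′

notPast⇒short : ∀ c {h h′ k} → NotPast c h′ k → Shift c h h′ → Short c h k
notPast⇒short true  h′≤k refl = h′≤k
notPast⇒short false k≤h′ refl = s≤s k≤h′

¬short⇒overshoot : ∀ c {h h₁ k} → ¬ Short c h k → Shift c h h₁ → Short (not c) h₁ k
¬short⇒overshoot true  h≮k refl = s≤s (≮⇒≥ h≮k)
¬short⇒overshoot false k≮h refl = ≮⇒≥ k≮h

notPast-short-excl : ∀ c {h k} → NotPast c h k → Short (not c) h k → ⊥
notPast-short-excl true  h≤k k<h = <⇒≱ k<h h≤k
notPast-short-excl false k≤h h<k = <⇒≱ h<k k≤h

continue-toward : ∀ c {h h₁ h′ k} → Short c h k → Shift c h h₁ → StepToward h₁ h′ k →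
                  Shift c h₁ h′ × NotPast c h′ k
continue-toward true  _ _ (true  , s′ , sh′) = sh′ , short⇒notPast true s′ sh′
continue-toward false _ _ (false , s′ , sh′) = sh′ , short⇒notPast false s′ sh′
continue-toward true  s sh (false , s′ , _)  = ⊥-elim (notPast-short-excl true (short⇒notPast true s sh) s′)
continue-toward false s sh (true  , s′ , _)  = ⊥-elim (notPast-short-excl false (short⇒notPast false s sh) s′)

stepToward-within : ∀ {a b h h′ k} → StepToward h h′ k → a ≤ h → h ≤ b → a ≤ k → k ≤ b →
                    a ≤ h′ × h′ ≤ b
stepToward-within (true  , h<k , refl) a≤h h≤b a≤k k≤b = ≤-trans a≤h (n≤1+n _) , ≤-trans h<k k≤b
stepToward-within (false , k<h , refl) a≤h h≤b a≤k k≤b = ≤-trans a≤k (≤-pred k<h) , ≤-trans (n≤1+n _) h≤b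

stepToward-0 : ∀ {h h′} → StepToward h h′ 0 → suc h′ ≡ h
stepToward-0 (false , _ , sh) = sh

setEdge-shiftˡ : (A : Adj m) (c : Bool) {v y : Fin m} → v ≢ y → A v y ≡ not c →
                 Shift c (deg A v) (deg (setEdge A v y c) v)
setEdge-shiftˡ A c {v} {y} v≢y Avy≡¬c = shift-from-𝟙 c
  (subst (λ b → deg (setEdge A v y c) v + 𝟙 b ≡ deg A v + 𝟙 c) Avy≡¬c (deg-setEdge-end A c v≢y))

setEdge-shiftʳ : (A : Adj m) (c : Bool) {v y : Fin m} → Symmetric A → v ≢ y → A v y ≡ not c →
                 Shift c (deg A y) (deg (setEdge A v y c) y)
setEdge-shiftʳ A c {v} {y} A-sym v≢y Avy≡¬c = subst (Shift c (deg A y))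
  (deg-cong (setEdge A y v c) (setEdge A v y c) y (setEdge-comm A c y v y))
  (setEdge-shiftˡ A c (v≢y ∘ ≡.sym) (trans (A-sym y v) Avy≡¬c))

module Augmenting (K : Adj m) (K-sym : Symmetric K) (K-loopless : Loopless K) where

  mismatch : Adj m → ℕ
  mismatch H = sum (deg (λ x z → H x z xor K x z))

  -- Switching H along an H/K-alternating walk that leaves v in direction c: the walk either
  -- ends at some z ≠ v, or closes up at v, which then moves twice.
  data Augmented (c : Bool) (H : Adj m) (v : Fin m) (H′ : Adj m) : Set where
    path  : ∀ z → z ≢ v → Shift c (deg H v) (deg H′ v) →
            StepToward (deg H z) (deg H′ z) (deg K z) →
            (∀ x → x ≢ v → x ≢ z → deg H′ x ≡ deg H x) → Augmented c H v H′
    cycle : ∀ h → Shift c (deg H v) h → Shift c h (deg H′ v) → NotPast c (deg H′ v) (deg K v) →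
            (∀ x → x ≢ v → deg H′ x ≡ deg H x) → Augmented c H v H′

  Augmentation : Bool → Adj m → Fin m → Set
  Augmentation c H v = Σ (Adj m) λ H′ → Symmetric H′ × H′ ⊆ H ∪ K × Augmented c H v H′

  ⊆∪-trans : ∀ {H H₁ H′} → H₁ ⊆ H ∪ K → H′ ⊆ H₁ ∪ K → H′ ⊆ H ∪ K
  ⊆∪-trans H₁⊆ H′⊆ x y e = [ H₁⊆ x y , inj₂ ]′ (H′⊆ x y e)

  ⊆∪-loopless : ∀ {H H₁} → Loopless H → H₁ ⊆ H ∪ K → Loopless H₁
  ⊆∪-loopless {H₁ = H₁} H-loopless H₁⊆ x with H₁ x x in eq
  ... | false = refl
  ... | true  = [ (λ e → contradiction (trans (≡.sym e) (H-loopless x)) λ ())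
                , (λ e → contradiction (trans (≡.sym e) (K-loopless x)) λ ())
                ]′ (H₁⊆ x x eq)

  mismatched-neighbour : ∀ c {H v} → Short c (deg H v) (deg K v) → ∃ λ y → H v y ≡ not c × K v y ≡ c
  mismatched-neighbour true  {H} {v} lt = deg-<⇒∃ H K v lt
  mismatched-neighbour false {H} {v} lt =
    let y , Kvy , Hvy = deg-<⇒∃ K H v lt in y , Hvy , Kvy

  mismatch-setEdge : ∀ {H v y c} → v ≢ y → H v y ≡ not c → K v y ≡ c →
                     mismatch (setEdge H v y c) < mismatch H
  mismatch-setEdge {H} {v} {y} {c} v≢y Hvy Kvy =
    sum-mono-< (λ x → deg-mono D₁ D x (λ z → setEdge-false-⊆ D v y x z ∘ trans (≡.sym (D₁≡ x z))))
               v (≤-reflexive (trans (cong suc (deg-cong D₁ (setEdge D v y false) v (D₁≡ v)))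
                                     (setEdge-shiftˡ D false v≢y Dvy)))
    where
    D D₁ : Adj m
    D  x z = H x z xor K x z
    D₁ x z = setEdge H v y c x z xor K x z
    Dvy : D v y ≡ true
    Dvy = trans (cong₂ _xor_ Hvy Kvy) (trans (≡.sym (not-distribˡ-xor c c)) (cong not (xor-same c)))
    D₁≡ : ∀ x z → D₁ x z ≡ setEdge D v y false x z
    D₁≡ x z = [ (λ e → trans (cong₂ _xor_ (setEdge-on H c e) (trans (edge-value K-sym e) Kvy))
                             (trans (xor-same c) (≡.sym (setEdge-on D false e))))
              , (λ ¬e → trans (cong (_xor K x z) (setEdge-off H c ¬e)) (≡.sym (setEdge-off D false ¬e)))
              ]′ (toSum (isEdge? v y x z))

  augment : ∀ c {H} v → Symmetric H → Loopless H → Acc _<_ (mismatch H) →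
            Short c (deg H v) (deg K v) → Augmentation c H v
  augment-via : ∀ c {H} v y → Symmetric H → Loopless H → Acc _<_ (mismatch H) →
                Short c (deg H v) (deg K v) → H v y ≡ not c → K v y ≡ c → Augmentation c H v

  augment c {H} v H-sym H-loopless accessible short =
    let y , Hvy , Kvy = mismatched-neighbour c {H} short
    in augment-via c v y H-sym H-loopless accessible short Hvy Kvy

  -- Switch vy to agree with K; if that pushes y past its K-degree, continue the walk from y in
  -- the opposite direction.
  augment-via c {H} v y H-sym H-loopless (acc smaller) short Hvy Kvy =
    extend (short? c (deg H y) (deg K y))
    where
    v≢y : v ≢ y
    v≢y refl = not-¬ (trans (≡.sym (K-loopless v)) Kvy) (trans (≡.sym (H-loopless v)) Hvy)
    y≢v : y ≢ v
    y≢v = v≢y ∘ ≡.sym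

    H₁ : Adj m
    H₁ = setEdge H v y c
    H₁⊆ : H₁ ⊆ H ∪ K
    H₁⊆ = setEdge-⊆ H c K K-sym Kvy
    shift-v : Shift c (deg H v) (deg H₁ v)
    shift-v = setEdge-shiftˡ H c v≢y Hvy
    shift-y : Shift c (deg H y) (deg H₁ y)
    shift-y = setEdge-shiftʳ H c H-sym v≢y Hvy
    fixed₁ : ∀ x → x ≢ v → x ≢ y → deg H₁ x ≡ deg H x
    fixed₁ = deg-setEdge-other H c

    unchanged : ∀ {H′} → deg H′ y ≡ deg H y → ∀ x → x ≢ v → (x ≢ y → deg H′ x ≡ deg H₁ x) →
                deg H′ x ≡ deg H x
    unchanged y-same x x≢v same₁ =
      [ (λ { refl → y-same }) , (λ x≢y → trans (same₁ x≢y) (fixed₁ x x≢v x≢y)) ]′ (toSum (x ≟ᶠ y))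

    from-path : ∀ {H′} z → z ≢ y → Shift (not c) (deg H₁ y) (deg H′ y) →
                StepToward (deg H₁ z) (deg H′ z) (deg K z) →
                (∀ x → x ≢ y → x ≢ z → deg H′ x ≡ deg H₁ x) → Dec (z ≡ v) → Augmented c H v H′
    from-path z z≢y shift-y′ step-z fixed′ (yes refl) =
      let shift-v′ , not-past = continue-toward c short shift-v step-z
      in cycle (deg H₁ v) shift-v shift-v′ not-past
           λ x x≢v → unchanged (shift-cancel c shift-y shift-y′) x x≢v λ x≢y → fixed′ x x≢y x≢v
    from-path {H′} z z≢y shift-y′ step-z fixed′ (no z≢v) =
      path z z≢v (subst (Shift c (deg H v)) (≡.sym (fixed′ v v≢y (z≢v ∘ ≡.sym))) shift-v)
           (subst (λ h → StepToward h (deg H′ z) (deg K z)) (fixed₁ z z≢v z≢y) step-z)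
           λ x x≢v x≢z → unchanged (shift-cancel c shift-y shift-y′) x x≢v λ x≢y → fixed′ x x≢y x≢z

    from-cycle : ∀ {H′} h → Shift (not c) (deg H₁ y) h → Shift (not c) h (deg H′ y) →
                 NotPast (not c) (deg H′ y) (deg K y) → (∀ x → x ≢ y → deg H′ x ≡ deg H₁ x) →
                 Augmented c H v H′
    from-cycle {H′} h shift₁ shift₂ not-past fixed′ =
      path y y≢v (subst (Shift c (deg H v)) (≡.sym (fixed′ v v≢y)) shift-v)
           (not c , notPast⇒short (not c) not-past retreat , retreat)
           λ x x≢v x≢y → trans (fixed′ x x≢y) (fixed₁ x x≢v x≢y)
      where
      retreat : Shift (not c) (deg H y) (deg H′ y)
      retreat = subst (λ h → Shift (not c) h (deg H′ y)) (shift-cancel c shift-y shift₁) shift₂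

    extend : Dec (Short c (deg H y) (deg K y)) → Augmentation c H v
    extend (yes short-y) =
      H₁ , setEdge-symmetric H c H-sym , H₁⊆ , path y y≢v shift-v (c , short-y , shift-y) fixed₁
    extend (no ¬short-y)
      with augment (not c) y (setEdge-symmetric H c H-sym) (⊆∪-loopless H-loopless H₁⊆)
                   (smaller (mismatch-setEdge v≢y Hvy Kvy)) (¬short⇒overshoot c ¬short-y shift-y)
    ... | H′ , H′-sym , H′⊆ , path z z≢y shift-y′ step-z fixed′ =
      H′ , H′-sym , ⊆∪-trans H₁⊆ H′⊆ , from-path z z≢y shift-y′ step-z fixed′ (z ≟ᶠ v)
    ... | H′ , H′-sym , H′⊆ , cycle h shift₁ shift₂ not-past fixed′ =
      H′ , H′-sym , ⊆∪-trans H₁⊆ H′⊆ , from-cycle h shift₁ shift₂ not-past fixed′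

  record Improvement (H : Adj m) (v : Fin m) : Set where
    field
      H′        : Adj m
      symmetric : Symmetric H′
      ⊆H∪K      : H′ ⊆ H ∪ K
      raised    : deg H v < deg H′ v
      ≤K        : deg H′ v ≤ deg K v
      moves     : ∀ x → x ≢ v → deg H′ x ≡ deg H x ⊎ StepToward (deg H x) (deg H′ x) (deg K x)

  improve : ∀ {H} v → Symmetric H → Loopless H → deg H v < deg K v → Improvement H v
  improve v H-sym H-loopless short
    with augment true v H-sym H-loopless (<-wellFounded _) short
  ... | H′ , H′-sym , H′⊆ , path z _ shift step fixed = record
    { H′ = H′ ; symmetric = H′-sym ; ⊆H∪K = H′⊆
    ; raised = ≤-reflexive (≡.sym shift)
    ; ≤K     = short⇒notPast true short shift
    ; moves  = λ x x≢v → [ (λ { refl → inj₂ step }) , (λ x≢z → inj₁ (fixed x x≢v x≢z)) ]′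
                           (toSum (x ≟ᶠ z))
    }
  ... | H′ , H′-sym , H′⊆ , cycle h shift₁ shift₂ not-past fixed = record
    { H′ = H′ ; symmetric = H′-sym ; ⊆H∪K = H′⊆
    ; raised = <-trans (≤-reflexive (≡.sym shift₁)) (≤-reflexive (≡.sym shift₂))
    ; ≤K     = not-past
    ; moves  = λ x x≢v → inj₁ (fixed x x≢v)
    }

climb-to : {A : Set} (P : A → Set) (f : A → ℕ) (a : ℕ) →
           (∀ {x} → P x → f x < a → ∃ λ y → P y × f x < f y) →
           ∀ {x} → P x → ∃ λ y → P y × a ≤ f y
climb-to P f a step px = go a px (m≤m+n a _)
  where
  go : ∀ k {x} → P x → a ≤ k + f x → ∃ λ y → P y × a ≤ f y
  go k {x} px bound with a ≤? f x
  ... | yes a≤fx = x , px , a≤fx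
  go zero    px bound | no a≰fx = contradiction bound a≰fx
  go (suc k) px bound | no a≰fx =
    let y , py , fx<fy = step px (≰⇒> a≰fx)
    in go k py (≤-trans bound (≤-trans (≤-reflexive (≡.sym (+-suc k _))) (+-monoʳ-≤ k fx<fy)))

∣p∣≡sum : (p : Subset m) → ∣ p ∣ ≡ sum (λ i → 𝟙 (lookup p i))
∣p∣≡sum []          = refl
∣p∣≡sum (true  ∷ p) = cong suc (∣p∣≡sum p)
∣p∣≡sum (false ∷ p) = ∣p∣≡sum p

∣⁅x⁆∪p∣≡1+∣p∣ : (x : Fin m) (p : Subset m) → x ∉ p → ∣ ⁅ x ⁆ Subset.∪ p ∣ ≡ suc ∣ p ∣
∣⁅x⁆∪p∣≡1+∣p∣ zero    (true  ∷ p) x∉p = contradiction here x∉p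
∣⁅x⁆∪p∣≡1+∣p∣ zero    (false ∷ p) x∉p = cong (suc ∘ ∣_∣) (∪-identityˡ p)
∣⁅x⁆∪p∣≡1+∣p∣ (suc x) (true  ∷ p) x∉p = cong suc (∣⁅x⁆∪p∣≡1+∣p∣ x p (x∉p ∘ there))
∣⁅x⁆∪p∣≡1+∣p∣ (suc x) (false ∷ p) x∉p = ∣⁅x⁆∪p∣≡1+∣p∣ x p (x∉p ∘ there)

module _ {x y : Fin m} {p : Subset m} where

  x∉⁅y⁆∪p⇒x∉p : x ∉ ⁅ y ⁆ Subset.∪ p → x ∉ p
  x∉⁅y⁆∪p⇒x∉p x∉ x∈p = x∉ (x∈p∪q⁺ (inj₂ x∈p))

  x≢y∧x∉p⇒x∉⁅y⁆∪p : x ≢ y → x ∉ p → x ∉ ⁅ y ⁆ Subset.∪ p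
  x≢y∧x∉p⇒x∉⁅y⁆∪p x≢y x∉p = [ x≢y ∘ x∈⁅y⁆⇒x≡y y , x∉p ]′ ∘ x∈p∪q⁻ ⁅ y ⁆ p

lookup≡false⇒∉ : (p : Subset m) (x : Fin m) → lookup p x ≡ false → x ∉ p
lookup≡false⇒∉ p x px≡false x∈p = contradiction (trans (≡.sym ([]=⇒lookup x∈p)) px≡false) λ ()

deletion-isolates : ∀ {G : Graph m} {S a b H x} → IsFactorOfDeletion G S a b H → x ∈ S → deg H x ≡ 0
deletion-isolates {H = H} {x} (_ , _ , H-avoids , _) x∈S = deg-isolated H x λ y e → H-avoids x y e x∈S

𝟙+𝟙<𝟙⇒ : ∀ b c d → 𝟙 b + 𝟙 c < 𝟙 d → b ≡ false × c ≡ false × d ≡ true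
𝟙+𝟙<𝟙⇒ false false true  _ = refl , refl , refl
𝟙+𝟙<𝟙⇒ false true  true  (s≤s ())
𝟙+𝟙<𝟙⇒ true  _     true  (s≤s ())
𝟙+𝟙<𝟙⇒ _     _     false ()

module _ (G : Graph m) (T : Subset m) (a b : ℕ) where

  record FactorExcept (v : Fin m) (H : Adj m) : Set where
    field
      symmetric : Symmetric H
      ⊆G        : ∀ x y → H x y ≡ true → adj G x y ≡ true
      avoids    : ∀ x y → H x y ≡ true → x ∉ T
      in-range  : ∀ x → x ∉ T → x ≢ v → a ≤ deg H x × deg H x ≤ b
      deg≤b     : deg H v ≤ b

    loopless : Loopless H
    loopless x with H x x in eq
    ... | false = refl
    ... | true  = contradiction (trans (≡.sym (⊆G x x eq)) (irref G x)) λ ()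

  deletion⇒FactorExcept : ∀ {v H} → IsFactorOfDeletion G (⁅ v ⁆ Subset.∪ T) a b H → FactorExcept v H
  deletion⇒FactorExcept {v} H-fac@(H-sym , H⊆G , H-avoids , H-range) = record
    { symmetric = H-sym
    ; ⊆G        = H⊆G
    ; avoids    = λ x y e → x∉⁅y⁆∪p⇒x∉p (H-avoids x y e)
    ; in-range  = λ x x∉T x≢v → H-range x (x≢y∧x∉p⇒x∉⁅y⁆∪p x≢v x∉T)
    ; deg≤b     = subst (_≤ b) (≡.sym (deletion-isolates {G = G} H-fac (x∈p∪q⁺ (inj₁ (x∈⁅x⁆ v))))) z≤n
    }

  FactorExcept⇒factor : ∀ {v H} → FactorExcept v H → a ≤ deg H v → IsFactorOfDeletion G T a b H
  FactorExcept⇒factor {v} H-fac a≤deg = symmetric , ⊆G , avoids , λ x x∉T →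
    [ (λ { refl → a≤deg , deg≤b }) , in-range x x∉T ]′ (toSum (x ≟ᶠ v))
    where open FactorExcept H-fac

  raise-by-augmenting : ∀ {v H w K} → v ∉ T → FactorExcept v H → deg H v < a →
                        w ∉ T → w ≢ v → a < deg H w →
                        IsFactorOfDeletion G (⁅ w ⁆ Subset.∪ T) a b K →
                        ∃ λ H′ → FactorExcept v H′ × deg H v < deg H′ v
  raise-by-augmenting {v} {H} {w} {K} v∉T H-fac short w∉T w≢v heavy K-del =
    H′ , record
      { symmetric = symmetric
      ; ⊆G        = λ x y e → [ Hf.⊆G x y , Kf.⊆G x y ]′ (⊆H∪K x y e)
      ; avoids    = λ x y e → [ Hf.avoids x y , Kf.avoids x y ]′ (⊆H∪K x y e)
      ; in-range  = in-range
      ; deg≤b     = ≤-trans ≤K (proj₂ (Kf.in-range v v∉T (w≢v ∘ ≡.sym)))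
      } , raised
    where
    module Hf = FactorExcept H-fac
    module Kf = FactorExcept (deletion⇒FactorExcept K-del)
    open Augmenting K Kf.symmetric Kf.loopless

    short-of-K : deg H v < deg K v
    short-of-K = <-≤-trans short (proj₁ (Kf.in-range v v∉T (w≢v ∘ ≡.sym)))

    open Improvement (improve v Hf.symmetric Hf.loopless short-of-K)

    -- w has no K-edges, so a step toward K can only lower its degree, and it starts above a.
    in-range-w : StepToward (deg H w) (deg H′ w) (deg K w) → a ≤ deg H′ w × deg H′ w ≤ b
    in-range-w step =
      let lowered = stepToward-0 (subst (StepToward (deg H w) (deg H′ w))
                                        (deletion-isolates {G = G} K-del (x∈p∪q⁺ (inj₁ (x∈⁅x⁆ w)))) step)
      in ≤-pred (subst (a <_) (≡.sym lowered) heavy) ,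
         ≤-trans (n≤1+n _) (subst (_≤ b) (≡.sym lowered) (proj₂ (Hf.in-range w w∉T w≢v)))

    in-range : ∀ x → x ∉ T → x ≢ v → a ≤ deg H′ x × deg H′ x ≤ b
    in-range x x∉T x≢v = [ unchanged , stepped ]′ (moves x x≢v)
      where
      unchanged : deg H′ x ≡ deg H x → a ≤ deg H′ x × deg H′ x ≤ b
      unchanged same = subst (λ d → a ≤ d × d ≤ b) (≡.sym same) (Hf.in-range x x∉T x≢v)
      stepped : StepToward (deg H x) (deg H′ x) (deg K x) → a ≤ deg H′ x × deg H′ x ≤ b
      stepped step = [ (λ { refl → in-range-w step })
                     , (λ x≢w → let a≤h , h≤b = Hf.in-range x x∉T x≢v
                                    a≤k , k≤b = Kf.in-range x x∉T x≢w
                                in stepToward-within step a≤h h≤b a≤k k≤b)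
                     ]′ (toSum (x ≟ᶠ w))

  free-neighbour : ∀ {H v} → deg H v + ∣ T ∣ < deg (adj G) v →
                   ∃ λ y → adj G v y ≡ true × H v y ≡ false × y ∉ T
  free-neighbour {H} {v} room =
    let y , 𝟙<𝟙 = sum-<⇒∃< (≡.subst₂ _<_ counted (deg≡sum (adj G) v) room)
        Hvy , Ty , Gvy = 𝟙+𝟙<𝟙⇒ (H v y) (lookup T y) (adj G v y) 𝟙<𝟙
    in y , Gvy , Hvy , lookup≡false⇒∉ T y Ty
    where
    counted : deg H v + ∣ T ∣ ≡ sum (λ y → 𝟙 (H v y) + 𝟙 (lookup T y))
    counted = ≡.sym (trans (∑-distrib-+ (λ y → 𝟙 (H v y)) (λ y → 𝟙 (lookup T y)))
                           (cong₂ _+_ (≡.sym (deg≡sum H v)) (≡.sym (∣p∣≡sum T))))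

  raise-by-new-edge : ∀ {v H y} → a < b → v ∉ T → FactorExcept v H → deg H v < a →
                      (∀ x → x ∉ T → x ≢ v → deg H x ≤ a) →
                      adj G v y ≡ true → H v y ≡ false → y ∉ T →
                      ∃ λ H′ → FactorExcept v H′ × deg H v < deg H′ v
  raise-by-new-edge {v} {H} {y} a<b v∉T H-fac short light Gvy Hvy y∉T =
    H′ , record
      { symmetric = setEdge-symmetric H true Hf.symmetric
      ; ⊆G        = λ x z e → [ Hf.⊆G x z , id ]′ (setEdge-⊆ H true (adj G) (Graph.sym G) Gvy x z e)
      ; avoids    = avoids
      ; in-range  = in-range
      ; deg≤b     = subst (_≤ b) (≡.sym shift-v) (≤-trans short (<⇒≤ a<b))
      } , ≤-reflexive (≡.sym shift-v)
    where
    module Hf = FactorExcept H-fac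
    v≢y : v ≢ y
    v≢y refl = contradiction (trans (≡.sym Gvy) (irref G v)) λ ()
    H′ = setEdge H v y true
    shift-v : deg H′ v ≡ suc (deg H v)
    shift-v = setEdge-shiftˡ H true v≢y Hvy

    avoids : ∀ x z → H′ x z ≡ true → x ∉ T
    avoids x z e = [ (λ { (inj₁ (refl , _)) → v∉T ; (inj₂ (refl , _)) → y∉T })
                   , (λ ¬e → Hf.avoids x z (trans (≡.sym (setEdge-off H true ¬e)) e))
                   ]′ (toSum (isEdge? v y x z))

    in-range : ∀ x → x ∉ T → x ≢ v → a ≤ deg H′ x × deg H′ x ≤ b
    in-range x x∉T x≢v = [ (λ { refl → at-y }) , elsewhere ]′ (toSum (x ≟ᶠ y))
      where
      elsewhere : x ≢ y → a ≤ deg H′ x × deg H′ x ≤ b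
      elsewhere x≢y = subst (λ d → a ≤ d × d ≤ b) (≡.sym (deg-setEdge-other H true x x≢v x≢y))
                        (Hf.in-range x x∉T x≢v)
      at-y : a ≤ deg H′ y × deg H′ y ≤ b
      at-y = subst (λ d → a ≤ d × d ≤ b) (≡.sym (setEdge-shiftʳ H true Hf.symmetric v≢y Hvy))
               (≤-trans (proj₁ (Hf.in-range y y∉T (v≢y ∘ ≡.sym))) (n≤1+n _) ,
                ≤-trans (s≤s (light y y∉T (v≢y ∘ ≡.sym))) a<b)

  raise : ∀ {n v H} → a < b → ∣ T ∣ ≡ n →
          (∀ S → ∣ S ∣ ≡ suc n → HasFactorAfterDeleting G S a b) → MinDegree≥ G (a + suc n) →
          v ∉ T → FactorExcept v H → deg H v < a → ∃ λ H′ → FactorExcept v H′ × deg H v < deg H′ v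
  raise {n} {v} {H} a<b ∣T∣≡n factors δ v∉T H-fac short
    with any? (λ w → ¬? (w ∈? T) ×-dec ¬? (w ≟ᶠ v) ×-dec a <? deg H w)
  ... | yes (w , w∉T , w≢v , heavy) =
    raise-by-augmenting v∉T H-fac short w∉T w≢v heavy
      (proj₂ (factors (⁅ w ⁆ Subset.∪ T) (trans (∣⁅x⁆∪p∣≡1+∣p∣ w T w∉T) (cong suc ∣T∣≡n))))
  ... | no no-heavy =
    let y , Gvy , Hvy , y∉T = free-neighbour {H} room
    in raise-by-new-edge a<b v∉T H-fac short light Gvy Hvy y∉T
    where
    light : ∀ x → x ∉ T → x ≢ v → deg H x ≤ a
    light x x∉T x≢v = ≮⇒≥ λ heavy → no-heavy (x , x∉T , x≢v , heavy)
    room : deg H v + ∣ T ∣ < deg (adj G) v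
    room = <-≤-trans (+-mono-< short (s≤s (≤-reflexive ∣T∣≡n))) (δ v)

theorem7 : (a b n m : ℕ) → 1 ≤ a → a < b → 1 ≤ n →
    (G : Graph m) → MinDegree≥ G (a + n) →
    ((S : Subset m) → ∣ S ∣ ≡ n → HasFactorAfterDeleting G S a b) →
    (T : Subset m) → ∣ T ∣ ≡ n ∸ 1 → HasFactorAfterDeleting G T a b
theorem7 a b (suc n) m _ a<b (s≤s z≤n) G δ factors T ∣T∣≡n with any? (λ v → ¬? (v ∈? T))
... | no T-full =
  (λ _ _ → false) , (λ _ _ → refl) , (λ _ _ ()) , (λ _ _ ()) , λ x x∉T → contradiction (x , x∉T) T-full
... | yes (v , v∉T) =
  let H₀ , H₀-del = factors (⁅ v ⁆ Subset.∪ T) (trans (∣⁅x⁆∪p∣≡1+∣p∣ v T v∉T) (cong suc ∣T∣≡n))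
      H , H-fac , a≤deg = climb-to (FactorExcept G T a b v) (λ H → deg H v) a
                            (raise G T a b a<b ∣T∣≡n factors δ v∉T)
                            (deletion⇒FactorExcept G T a b H₀-del)
  in H , FactorExcept⇒factor G T a b H-fac a≤deg
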